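{- Let $\mathtt{MSA}[1..m,1..n]$ be a gapless multiple sequence alignment, let $v(j)$ be as defined below, let $s$ be defined by the recurrence $s(j)=\min_{1\le j'\le v(j)}\max(j-j',s(j'))$, and let $x(j)=\max\ \mathrm{Argmin}_{j'\in[1..v(j)]}\max(j-j',s(j'))$. Then for every $j\in[1..n-1]$ with $v(j)\ge 1$, we have $x(j)\le x(j+1)$.
   Context: A gapless MSA consists of $m$ rows, each a string of length $n$. The segment $\mathtt{MSA}[1..m,a..j]$ is valid if for every row $i$, the string $\mathtt{MSA}[i,a..j]$ occurs (as a substring of any row) only at starting column $a$. $v(j)$ is the largest integer such that $\mathtt{MSA}[1..m,v(j)+1..j]$ is valid, with $v(j)=0$ if none exists; these values satisfy $v(1)\le v(2)\le\cdots\le v(n)$. $\mathrm{Argmin}$ denotes the set of minimizers, and $\max\mathrm{Argmin}$ the largest minimizer. The value $s(j)$ is the minimum, over valid segmentations of the prefix $\mathtt{MSA}[1..m,1..j]$, of the maximum segment width; it satisfies the stated recurrence. -}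

module Defs where

open import Data.Nat using (ℕ; zero; suc; _+_; _∸_; _≤_; _⊔_; _⊓_)
open import Data.Fin using (Fin)
open import Data.Product using (_×_)
open import Data.Sum using (_⊎_)
open import Relation.Binary.PropositionalEquality using (_≡_)
open import Relation.Nullary using (¬_)

-- Columns are 1-based as in the paper: row i, column c is  M i c  for 1 ≤ c ≤ n.
-- Values at columns outside [1..n] are never inspected by the definitions below.
MSA : Set → ℕ → Set
MSA A m = Fin m → ℕ → A

module _ {A : Set} {m : ℕ} (n : ℕ) (M : MSA A m) where

  OccursAt : Fin m → ℕ → ℕ → Fin m → ℕ → Set
  OccursAt i a j i' b =
    1 ≤ b × b + (j ∸ a) ≤ n × (∀ k → k ≤ j ∸ a → M i' (b + k) ≡ M i (a + k))

  Valid : ℕ → ℕ → Set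
  Valid a j =
    1 ≤ a × a ≤ j × j ≤ n ×
    (∀ i i' b → OccursAt i a j i' b → b ≡ a)

  IsV : ℕ → ℕ → Set
  IsV j v =
    (Valid (suc v) j × (∀ v' → Valid (suc v') j → v' ≤ v))
    ⊎ (v ≡ 0 × (∀ v' → ¬ Valid (suc v') j))

-- Extended naturals (∞ = no valid segmentation).
data ℕ∞ : Set where
  fin : ℕ → ℕ∞
  ∞   : ℕ∞

_⊔∞_ : ℕ∞ → ℕ∞ → ℕ∞
fin a ⊔∞ fin b = fin (a ⊔ b)
fin _ ⊔∞ ∞ = ∞
∞ ⊔∞ _ = ∞

_⊓∞_ : ℕ∞ → ℕ∞ → ℕ∞
fin a ⊓∞ fin b = fin (a ⊓ b)
fin a ⊓∞ ∞ = fin a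
∞ ⊓∞ y = y

data _≤∞_ : ℕ∞ → ℕ∞ → Set where
  fin≤fin : ∀ {a b} → a ≤ b → fin a ≤∞ fin b
  _≤∞∞    : ∀ x → x ≤∞ ∞

minOver : (ℕ → ℕ∞) → ℕ → ℕ∞
minOver f zero = ∞
minOver f (suc k) = minOver f k ⊓∞ f (suc k)

IsMaxArgmin : (ℕ → ℕ∞) → ℕ → ℕ → Set
IsMaxArgmin f k x =
  1 ≤ x × x ≤ k ×
  (∀ j' → 1 ≤ j' → j' ≤ k → f x ≤∞ f j') ×
  (∀ j' → 1 ≤ j' → j' ≤ k → f j' ≤∞ f x → j' ≤ x)

objective : (ℕ → ℕ∞) → ℕ → ℕ → ℕ∞
objective s j j' = fin (j ∸ j') ⊔∞ s j'

-- s satisfies the recurrence for every j ∈ [1..n]: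
--  * if v(j) ≥ 1:  s(j) = min_{1≤j'≤v(j)} max(j - j', s(j'));
--  * if v(j) = 0:  the only possible segmentation of the prefix is the single
--    segment [1..j], so s(j) = j if it is valid and ∞ otherwise.
IsS : {A : Set} {m : ℕ} (n : ℕ) (M : MSA A m) → (ℕ → ℕ) → (ℕ → ℕ∞) → Set
IsS n M v s = ∀ j → 1 ≤ j → j ≤ n →
  (1 ≤ v j → s j ≡ minOver (objective s j) (v j)) ×
  (v j ≡ 0 → (Valid n M 1 j → s j ≡ fin j) × (¬ Valid n M 1 j → s j ≡ ∞))

module Submission where

open import Defs
open import Data.Nat using (ℕ; suc; _≤_; _∸_; _⊔_; z≤n; s≤s; _≤?_)
open import Data.Nat.Properties
open import Data.Product using (_,_)
open import Data.Sum using (inj₁; inj₂)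
open import Data.Empty using (⊥-elim)
open import Relation.Nullary using (yes; no)
open import Relation.Binary.PropositionalEquality using (refl)

-- Extending a valid segment MSA[a..j] by one column keeps it valid: any second
-- occurrence of the longer strings would contain one of the shorter strings.
Valid-suc : ∀ {A : Set} {m} n (M : MSA A m) {a j} → suc j ≤ n →
  Valid n M a j → Valid n M a (suc j)
Valid-suc n M {a} {j} sj≤n (1≤a , a≤j , _ , unique) =
  1≤a , m≤n⇒m≤1+n a≤j , sj≤n ,
  λ i i' b (1≤b , fits , agree) →
    unique i i' b (1≤b , ≤-trans (+-monoʳ-≤ b shorter) fits ,
                   λ k k≤ → agree k (≤-trans k≤ shorter))
  where
  shorter : j ∸ a ≤ suc j ∸ a
  shorter = ∸-monoˡ-≤ a (n≤1+n j)

IsV-mono : ∀ {A : Set} {m} n (M : MSA A m) {j w w'} → suc j ≤ n →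
  IsV n M j w → IsV n M (suc j) w' → w ≤ w'
IsV-mono n M sj≤n (inj₁ (valid , _)) (inj₁ (_ , largest)) = largest _ (Valid-suc n M sj≤n valid)
IsV-mono n M sj≤n (inj₁ (valid , _)) (inj₂ (_ , none))    = ⊥-elim (none _ (Valid-suc n M sj≤n valid))
IsV-mono n M sj≤n (inj₂ (refl , _))  _                    = z≤n

-- Passing from j to j + 1 raises the width j - b of the later-starting
-- candidate's last segment by one, and that of the earlier one by at most one.
∸-⊔-suc-mono : ∀ {j a b p q} → b ≤ a →
  (j ∸ a) ⊔ p ≤ (j ∸ b) ⊔ q → (suc j ∸ a) ⊔ p ≤ (suc j ∸ b) ⊔ q
∸-⊔-suc-mono {j} {a} {b} {p} {q} b≤a h = ⊔-lub
  (≤-trans (∸-monoʳ-≤ (suc j) b≤a) (m≤m⊔n _ q))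
  (≤-trans (m≤n⊔m (j ∸ a) p) (≤-trans h (⊔-monoˡ-≤ q (∸-monoˡ-≤ b (n≤1+n j)))))

objective-suc-mono : ∀ s {j a b} → b ≤ a →
  objective s j a ≤∞ objective s j b → objective s (suc j) a ≤∞ objective s (suc j) b
objective-suc-mono s {a = a} {b} b≤a h with s a | s b | h
... | fin _ | fin _ | fin≤fin h′ = fin≤fin (∸-⊔-suc-mono b≤a h′)
... | fin _ | ∞     | _         = _ ≤∞∞
... | ∞     | ∞     | _         = _ ≤∞∞

-- The hypothesis on f and g is a single-crossing condition, as in monotone
-- comparative statics.
IsMaxArgmin-mono : ∀ {f g : ℕ → ℕ∞} {k k' x₁ x₂} → k ≤ k' →
  (∀ {a b} → b ≤ a → f a ≤∞ f b → g a ≤∞ g b) →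
  IsMaxArgmin f k x₁ → IsMaxArgmin g k' x₂ → x₁ ≤ x₂
IsMaxArgmin-mono {x₁ = x₁} {x₂} k≤k' preserve
  (1≤x₁ , x₁≤k , minimal₁ , _) (1≤x₂ , _ , _ , largest₂) with x₁ ≤? x₂
... | yes x₁≤x₂ = x₁≤x₂
... | no  x₁≰x₂ = largest₂ x₁ 1≤x₁ (≤-trans x₁≤k k≤k')
                    (preserve x₂≤x₁ (minimal₁ x₂ 1≤x₂ (≤-trans x₂≤x₁ x₁≤k)))
  where
  x₂≤x₁ : x₂ ≤ x₁
  x₂≤x₁ = <⇒≤ (≰⇒> x₁≰x₂)

lemma10 : {A : Set} (m n : ℕ) (M : MSA A m) (v : ℕ → ℕ) (s : ℕ → ℕ∞) →
    (∀ j → 1 ≤ j → j ≤ n → IsV n M j (v j)) →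
    IsS n M v s →
    ∀ j (x₁ x₂ : ℕ) → 1 ≤ j → suc j ≤ n → 1 ≤ v j →
    IsMaxArgmin (objective s j) (v j) x₁ →
    IsMaxArgmin (objective s (suc j)) (v (suc j)) x₂ →
    x₁ ≤ x₂
lemma10 _ n M v s isV _ j _ _ 1≤j sj≤n _ =
  IsMaxArgmin-mono vj≤vsj (objective-suc-mono s)
  where
  vj≤vsj : v j ≤ v (suc j)
  vj≤vsj = IsV-mono n M sj≤n (isV j 1≤j (<⇒≤ sj≤n)) (isV (suc j) (s≤s z≤n) sj≤n)
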